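{- Let $f$ be an additive function taking nonnegative integer values with $f(p)\ge1$ for every prime $p$. Let $n=\prod_{i=1}^k p_i^{e_i}$ with distinct primes $p_i$ and $e_i\ge1$. Then $n$ is $f$-practical if and only if $$f(p_i^e)\le 1+\sum_{\substack{d\mid n\\ f(d)<f(p_i^e)}} f(d)$$ holds for every $1\le i\le k$ and every $1\le e\le e_i$.
   Context: $f$ is additive means $f(ab)=f(a)+f(b)$ whenever $\gcd(a,b)=1$ (so $f(1)=0$). $S_f(n)=\sum_{d\mid n}f(d)$, and $n$ is $f$-practical if every positive integer $m\le S_f(n)$ can be written as $\sum_{d\in\mathcal{D}}f(d)$ for some set $\mathcal{D}$ of divisors of $n$. -}

module Defs where

open import Data.Nat using (ℕ; suc; _+_; _*_; _^_; _≤_; _<_; _<?_)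
open import Data.Nat.Divisibility using (_∣_; _∣?_)
open import Data.Nat.Coprimality using (Coprime)
open import Data.Nat.Primality using (Prime)
open import Data.List using (List; map; filter; upTo)
open import Data.Nat.ListAction using (sum)
open import Data.List.Relation.Binary.Sublist.Propositional using (_⊆_)
open import Data.Product using (∃; _×_)
open import Relation.Binary.PropositionalEquality using (_≡_)

Additive : (ℕ → ℕ) → Set
Additive f = ∀ a b → 0 < a → 0 < b → Coprime a b → f (a * b) ≡ f a + f b

divisors : ℕ → List ℕ
divisors n = filter (_∣? n) (map suc (upTo n))

Sf : (ℕ → ℕ) → ℕ → ℕ
Sf f n = sum (map f (divisors n))

-- n is f-practical: every 1 ≤ m ≤ S_f(n) is Σ_{d ∈ D} f(d) for a set D of divisors of n
-- (a set of divisors = a sublist of the duplicate-free list of divisors)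
Practical : (ℕ → ℕ) → ℕ → Set
Practical f n = ∀ m → 1 ≤ m → m ≤ Sf f n →
  ∃ λ (D : List ℕ) → (D ⊆ divisors n) × (sum (map f D) ≡ m)

smallSum : (ℕ → ℕ) → ℕ → ℕ → ℕ
smallSum f n x = sum (map f (filter (λ d → f d <? x) (divisors n)))

{-# OPTIONS --safe #-}
-- For a list xs of items with weights w, every m ≤ weight xs is the weight of a sublist iff
-- each x in xs satisfies w x ≤ 1 + (total weight of the items strictly lighter than x).
-- Necessity: a sublist of weight w x − 1 consists of strictly lighter items. Sufficiency:
-- remove a heaviest item y; the condition survives for the rest, and every target is reached
-- either without y or as w y plus a target below the rest's total, because w y ≤ 1 + that total.
-- Applied to the divisors of n weighted by f, the condition for all divisors follows from the
-- one for prime powers by strong induction: for d = pᵉ r with p ∤ r, f d = f (pᵉ) + f r, and if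
-- both summands are positive then pᵉ and r are distinct divisors strictly lighter than d.
module Submission where

open import Defs
open import Data.Empty using (⊥-elim)
open import Data.List using (List; []; _∷_; _++_; map; filter; length; upTo)
open import Data.List.Extrema.Nat using (argmax; argmax-sel; f[⊥]≤f[argmax]; f[xs]≤f[argmax])
open import Data.List.Membership.Propositional using (_∈_)
open import Data.List.Membership.Propositional.Properties
  using (∈-filter⁺; ∈-filter⁻; ∈-map⁺; ∈-upTo⁺; ∈-∃++; ∈-insert)
open import Data.List.Properties using (map-++; filter-++; filter-all; filter-reject; length-++-sucʳ)
open import Data.List.Relation.Binary.Sublist.Propositional
  using (_⊆_; []; _∷_; _∷ʳ_; ⊆-refl; ⊆-trans; minimum)
open import Data.List.Relation.Binary.Sublist.Propositional.Properties using (++⁺; filter⁺; filter-⊆)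
open import Data.List.Relation.Unary.All as All using (All; []; _∷_)
open import Data.List.Relation.Unary.Any using (here; there)
open import Data.Nat
  using ( ℕ; zero; suc; _+_; _*_; _∸_; _^_; _≤_; _<_; z≤n; s≤s; z<s
        ; >-nonZero; nonTrivial⇒n>1; n>1⇒nonTrivial)
open import Data.Nat.Coprimality as Coprimality using (Coprime; coprime-divisor)
open import Data.Nat.Divisibility
open import Data.Nat.Induction using (<-rec)
open import Data.Nat.ListAction using (sum)
open import Data.Nat.ListAction.Properties using (sum-++)
open import Data.Nat.Primality
  using (Prime; prime; composite?; prime⇒irreducible; prime⇒nonTrivial)
open import Data.Nat.Properties
open import Data.Product using (∃; ∃₂; _×_; _,_; proj₂)
open import Data.Sum using (_⊎_; inj₁; inj₂)
open import Function using (_∘_)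
open import Function.Bundles using (_⇔_; mk⇔)
open import Function.Construct.Composition using (_⇔-∘_)
open import Relation.Nullary using (yes; no)
open import Relation.Binary.PropositionalEquality
open import Algebra.Properties.CommutativeSemigroup +-commutativeSemigroup
  using () renaming (x∙yz≈y∙xz to m+[n+o]≡n+[m+o])
open import Algebra.Properties.CommutativeSemigroup *-commutativeSemigroup
  using () renaming (xy∙z≈zx∙y to m*n*o≡o*m*n)

⊆-++-split : ∀ {a} {A : Set a} (xs : List A) {ys zs : List A} → zs ⊆ xs ++ ys →
  ∃₂ λ us vs → zs ≡ us ++ vs × us ⊆ xs × vs ⊆ ys
⊆-++-split [] τ = [] , _ , refl , [] , τ
⊆-++-split (x ∷ xs) (.x ∷ʳ τ) with us , vs , refl , σ , ρ ← ⊆-++-split xs τ =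
  us , vs , refl , x ∷ʳ σ , ρ
⊆-++-split (x ∷ xs) (refl ∷ τ) with us , vs , refl , σ , ρ ← ⊆-++-split xs τ =
  x ∷ us , vs , refl , refl ∷ σ , ρ

All-delete : ∀ {a p} {A : Set a} {P : A → Set p} xs {y : A} ys →
  All P (xs ++ y ∷ ys) → All P (xs ++ ys)
All-delete [] ys (_ ∷ pys) = pys
All-delete (x ∷ xs) ys (px ∷ pxs) = px ∷ All-delete xs ys pxs

module Weighted {a} {A : Set a} (w : A → ℕ) where

  weight : List A → ℕ
  weight xs = sum (map w xs)

  lighterThan : ℕ → List A → List A
  lighterThan t = filter (λ x → w x <? t)

  Reachable : List A → ℕ → Set
  Reachable xs t = t ≤ 1 + weight (lighterThan t xs)

  Complete : List A → Set a
  Complete xs = ∀ m → m ≤ weight xs → ∃ λ ys → ys ⊆ xs × weight ys ≡ m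

  weight-++ : ∀ xs ys → weight (xs ++ ys) ≡ weight xs + weight ys
  weight-++ xs ys = trans (cong sum (map-++ w xs ys)) (sum-++ (map w xs) (map w ys))

  weight-insert : ∀ xs y ys → weight (xs ++ y ∷ ys) ≡ w y + weight (xs ++ ys)
  weight-insert xs y ys = begin
    weight (xs ++ y ∷ ys)         ≡⟨ weight-++ xs (y ∷ ys) ⟩
    weight xs + (w y + weight ys) ≡⟨ m+[n+o]≡n+[m+o] (weight xs) (w y) (weight ys) ⟩
    w y + (weight xs + weight ys) ≡⟨ cong (w y +_) (weight-++ xs ys) ⟨
    w y + weight (xs ++ ys)       ∎
    where open ≡-Reasoning

  weight-mono-⊆ : ∀ {xs ys} → xs ⊆ ys → weight xs ≤ weight ys
  weight-mono-⊆ [] = z≤n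
  weight-mono-⊆ (y ∷ʳ τ) = ≤-trans (weight-mono-⊆ τ) (m≤n+m _ (w y))
  weight-mono-⊆ (refl ∷ τ) = +-monoʳ-≤ _ (weight-mono-⊆ τ)

  ∈⇒w≤weight : ∀ {x xs} → x ∈ xs → w x ≤ weight xs
  ∈⇒w≤weight {xs = x ∷ xs} (here refl) = m≤m+n (w x) (weight xs)
  ∈⇒w≤weight {xs = y ∷ xs} (there x∈xs) = ≤-trans (∈⇒w≤weight x∈xs) (m≤n+m _ (w y))

  distinct∈⇒w+w≤weight : ∀ {x y xs} → x ∈ xs → y ∈ xs → x ≢ y → w x + w y ≤ weight xs
  distinct∈⇒w+w≤weight (here refl) (here refl) x≢y = ⊥-elim (x≢y refl)
  distinct∈⇒w+w≤weight (here refl) (there y∈xs) _ = +-monoʳ-≤ _ (∈⇒w≤weight y∈xs)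
  distinct∈⇒w+w≤weight {x} {y} {_ ∷ xs} (there x∈xs) (here refl) _ =
    subst (_≤ w y + weight xs) (+-comm (w y) (w x)) (+-monoʳ-≤ (w y) (∈⇒w≤weight x∈xs))
  distinct∈⇒w+w≤weight {xs = z ∷ xs} (there x∈xs) (there y∈xs) x≢y =
    ≤-trans (distinct∈⇒w+w≤weight x∈xs y∈xs x≢y) (m≤n+m _ (w z))

  weight-lighterThan-≤ : ∀ t xs → weight (lighterThan t xs) ≤ weight xs
  weight-lighterThan-≤ t xs = weight-mono-⊆ (filter-⊆ (λ x → w x <? t) xs)

  weight-⊆-lighterThan : ∀ {t xs ys} → ys ⊆ xs → All (λ y → w y < t) ys →
    weight ys ≤ weight (lighterThan t xs)
  weight-⊆-lighterThan {t} ys⊆xs light =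
    subst (_≤ _) (cong weight (filter-all (λ x → w x <? t) light))
      (weight-mono-⊆ (filter⁺ (λ x → w x <? t) (λ x → w x <? t) (λ { refl → λ p → p }) ys⊆xs))

  lighterThan-insert : ∀ {t} xs y ys → t ≤ w y →
    lighterThan t (xs ++ y ∷ ys) ≡ lighterThan t (xs ++ ys)
  lighterThan-insert {t} xs y ys t≤wy = begin
    lighterThan t (xs ++ y ∷ ys)               ≡⟨ filter-++ (λ x → w x <? t) xs (y ∷ ys) ⟩
    lighterThan t xs ++ lighterThan t (y ∷ ys) ≡⟨ cong (lighterThan t xs ++_)
                                                    (filter-reject (λ x → w x <? t) (≤⇒≯ t≤wy)) ⟩
    lighterThan t xs ++ lighterThan t ys       ≡⟨ filter-++ (λ x → w x <? t) xs ys ⟨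
    lighterThan t (xs ++ ys)                   ∎
    where open ≡-Reasoning

  reachable-delete : ∀ xs y ys {t} → t ≤ w y →
    Reachable (xs ++ y ∷ ys) t → Reachable (xs ++ ys) t
  reachable-delete xs y ys t≤wy =
    subst (λ zs → _ ≤ 1 + weight zs) (lighterThan-insert xs y ys t≤wy)

  reachable-+ : ∀ {x y xs} → x ∈ xs → y ∈ xs → x ≢ y →
    Reachable xs (w x) → Reachable xs (w y) → Reachable xs (w x + w y)
  reachable-+ {x} {y} {xs} x∈xs y∈xs x≢y rx ry with w x ≟ 0 | w y ≟ 0
  ... | yes wx≡0 | _ = subst (Reachable xs) (cong (_+ w y) (sym wx≡0)) ry
  ... | no _ | yes wy≡0 =
    subst (Reachable xs) (trans (sym (+-identityʳ (w x))) (cong (w x +_) (sym wy≡0))) rx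
  ... | no wx≢0 | no wy≢0 = ≤-trans
      (distinct∈⇒w+w≤weight (∈-filter⁺ _ x∈xs (m<m+n (w x) (n≢0⇒n>0 wy≢0)))
                         (∈-filter⁺ _ y∈xs (m<n+m (w y) (n≢0⇒n>0 wx≢0))) x≢y)
      (n≤1+n _)

  complete⇒reachable : ∀ {xs} → Complete xs → All (Reachable xs ∘ w) xs
  complete⇒reachable {xs} complete = All.tabulate reachable
    where
    reachable : ∀ {x} → x ∈ xs → Reachable xs (w x)
    reachable {x} x∈xs with w x | ∈⇒w≤weight x∈xs
    ... | zero | _ = z≤n
    ... | suc k | k<weight with ys , ys⊆xs , weight≡k ← complete k (<⇒≤ k<weight) =
      s≤s (subst (_≤ _) weight≡k (weight-⊆-lighterThan ys⊆xs
        (All.tabulate λ y∈ys → s≤s (subst (_ ≤_) weight≡k (∈⇒w≤weight y∈ys)))))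

  complete-insert : ∀ xs y ys → w y ≤ 1 + weight (xs ++ ys) →
    Complete (xs ++ ys) → Complete (xs ++ y ∷ ys)
  complete-insert xs y ys wy≤ complete m m≤ with m ≤? weight (xs ++ ys)
  ... | yes m≤rest with zs , zs⊆ , weight≡m ← complete m m≤rest =
    zs , ⊆-trans zs⊆ (++⁺ ⊆-refl (y ∷ʳ ⊆-refl)) , weight≡m
  ... | no m≰rest
    with zs , zs⊆ , weight≡ ← complete (m ∸ w y)
           (m≤n+o⇒m∸n≤o m (w y) (subst (m ≤_) (weight-insert xs y ys) m≤))
    with us , vs , refl , us⊆ , vs⊆ ← ⊆-++-split xs zs⊆ =
    us ++ y ∷ vs , ++⁺ us⊆ (refl ∷ vs⊆) , (begin
      weight (us ++ y ∷ vs)   ≡⟨ weight-insert us y vs ⟩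
      w y + weight (us ++ vs) ≡⟨ cong (w y +_) weight≡ ⟩
      w y + (m ∸ w y)         ≡⟨ m+[n∸m]≡n (≤-trans wy≤ (≰⇒> m≰rest)) ⟩
      m                       ∎)
    where open ≡-Reasoning

  argmax∈ : ∀ x xs → argmax w x xs ∈ x ∷ xs
  argmax∈ x xs with argmax-sel w x xs
  ... | inj₁ ≡x = here ≡x
  ... | inj₂ ∈xs = there ∈xs

  heaviest-split : ∀ xs → 0 < length xs → ∃₂ λ us vs → ∃ λ y →
    xs ≡ us ++ y ∷ vs × All (λ z → w z ≤ w y) (us ++ vs)
  heaviest-split (x ∷ xs) _ with us , vs , eq ← ∈-∃++ (argmax∈ x xs) =
    us , vs , argmax w x xs , eq ,
    All-delete us vs
      (subst (All _) eq (f[⊥]≤f[argmax] {f = w} x xs ∷ f[xs]≤f[argmax] {f = w} x xs))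

  reachable⇒complete : ∀ {xs} → All (Reachable xs ∘ w) xs → Complete xs
  reachable⇒complete {xs} = go (length xs) xs refl
    where
    go : ∀ n xs → length xs ≡ n → All (Reachable xs ∘ w) xs → Complete xs
    go zero [] _ _ m m≤0 = [] , [] , sym (n≤0⇒n≡0 m≤0)
    go (suc n) xs len reachable
      with us , vs , y , refl , heaviest ← heaviest-split xs (subst (0 <_) (sym len) z<s) =
      complete-insert us y vs
        (≤-trans (reachable-delete us y vs ≤-refl (All.lookup reachable (∈-insert us)))
                 (+-monoʳ-≤ 1 (weight-lighterThan-≤ (w y) (us ++ vs))))
        (go n (us ++ vs) (suc-injective (trans (sym (length-++-sucʳ us y vs)) len))
          (All.zipWith (λ (z≤y , rz) → reachable-delete us y vs z≤y rz)
                       (heaviest , All-delete us vs reachable)))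

  complete⇔reachable : ∀ {xs} → Complete xs ⇔ All (Reachable xs ∘ w) xs
  complete⇔reachable = mk⇔ complete⇒reachable reachable⇒complete

∃-prime-divisor : ∀ {n} → 1 < n → ∃ λ p → Prime p × p ∣ n
∃-prime-divisor {n} = <-rec (λ n → 1 < n → ∃ λ p → Prime p × p ∣ n) prime-divisor n
  where
  prime-divisor : ∀ n → (∀ {m} → m < n → 1 < m → ∃ λ p → Prime p × p ∣ m) →
    1 < n → ∃ λ p → Prime p × p ∣ n
  prime-divisor n rec 1<n with composite? n
  ... | yes (hasNonTrivialDivisor {d} d<n d∣n)
    with p , p-prime , p∣d ← rec d<n (nonTrivial⇒n>1 d) = p , p-prime , ∣-trans p∣d d∣n
  ... | no ¬composite = n , prime {{n>1⇒nonTrivial 1<n}} ¬composite , ∣-refl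

p-free-split : ∀ {p} → 1 < p → ∀ d → 0 < d → ∃₂ λ e r → d ≡ p ^ e * r × p ∤ r
p-free-split {p} 1<p = <-rec (λ d → 0 < d → ∃₂ λ e r → d ≡ p ^ e * r × p ∤ r) split
  where
  split : ∀ d → (∀ {d′} → d′ < d → 0 < d′ → ∃₂ λ e r → d′ ≡ p ^ e * r × p ∤ r) →
    0 < d → ∃₂ λ e r → d ≡ p ^ e * r × p ∤ r
  split d rec d>0 with p ∣? d
  ... | no p∤d = 0 , d , sym (*-identityˡ d) , p∤d
  split .(zero * p) _ () | yes (divides-refl zero)
  split .(suc q * p) rec _ | yes (divides-refl (suc q))
    with e , r , q≡ , p∤r ← rec (m<m*n (suc q) p 1<p) z<s =
    suc e , r , trans (cong (_* p) q≡) (m*n*o≡o*m*n (p ^ e) r p) , p∤r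

prime⇒>1 : ∀ {p} → Prime p → 1 < p
prime⇒>1 {p} p-prime = nonTrivial⇒n>1 p {{prime⇒nonTrivial p-prime}}

prime-power-split : ∀ {d} → 1 < d → ∃ λ p → ∃₂ λ e r → Prime p × d ≡ p ^ suc e * r × p ∤ r
prime-power-split {d} 1<d with p , p-prime , p∣d ← ∃-prime-divisor 1<d
  with p-free-split (prime⇒>1 p-prime) d (<-trans z<s 1<d)
... | zero , r , refl , p∤r = ⊥-elim (p∤r (subst (p ∣_) (*-identityˡ r) p∣d))
... | suc e , r , d≡ , p∤r = p , e , r , p-prime , d≡ , p∤r

prime∤⇒coprime : ∀ {p n} → Prime p → p ∤ n → Coprime p n
prime∤⇒coprime p-prime p∤n (d∣p , d∣n) with prime⇒irreducible p-prime d∣p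
... | inj₁ d≡1 = d≡1
... | inj₂ refl = ⊥-elim (p∤n d∣n)

∣p^e⇒≡1⊎p∣ : ∀ {p d} e → Prime p → d ∣ p ^ e → d ≡ 1 ⊎ p ∣ d
∣p^e⇒≡1⊎p∣ zero _ d∣1 = inj₁ (∣1⇒≡1 d∣1)
∣p^e⇒≡1⊎p∣ {p} {d} (suc e) p-prime d∣p^1+e with p ∣? d
... | yes p∣d = inj₂ p∣d
... | no p∤d = ∣p^e⇒≡1⊎p∣ e p-prime
  (coprime-divisor (Coprimality.sym (prime∤⇒coprime p-prime p∤d)) d∣p^1+e)

prime^-coprime : ∀ {p r} e → Prime p → p ∤ r → Coprime (p ^ e) r
prime^-coprime e p-prime p∤r (d∣p^e , d∣r) with ∣p^e⇒≡1⊎p∣ e p-prime d∣p^e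
... | inj₁ d≡1 = d≡1
... | inj₂ p∣d = ⊥-elim (p∤r (∣-trans p∣d d∣r))

∣⇒>0 : ∀ {d n} → 0 < n → d ∣ n → 0 < d
∣⇒>0 n>0 d∣n = n≢0⇒n>0 λ { refl → >⇒≢ n>0 (0∣⇒≡0 d∣n) }

∣⇒∈-divisors : ∀ {d n} → 0 < n → d ∣ n → d ∈ divisors n
∣⇒∈-divisors {zero} n>0 0∣n = ⊥-elim (>⇒≢ n>0 (0∣⇒≡0 0∣n))
∣⇒∈-divisors {suc d} {n@(suc _)} _ d∣n =
  ∈-filter⁺ (_∣? n) (∈-map⁺ suc (∈-upTo⁺ (∣⇒≤ d∣n))) d∣n

∈-divisors⇒∣ : ∀ {d n} → d ∈ divisors n → d ∣ n
∈-divisors⇒∣ {n = n} d∈ = proj₂ (∈-filter⁻ (_∣? n) {xs = map suc (upTo n)} d∈)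

Additive⇒f[1]≡0 : ∀ {f} → Additive f → f 1 ≡ 0
Additive⇒f[1]≡0 {f} additive = +-cancelˡ-≡ (f 1) (f 1) 0 (begin
  f 1 + f 1 ≡⟨ additive 1 1 z<s z<s (Coprimality.1-coprimeTo 1) ⟨
  f 1       ≡⟨ +-identityʳ (f 1) ⟨
  f 1 + 0   ∎)
  where open ≡-Reasoning

practical⇔complete : ∀ {f n} → Practical f n ⇔ Weighted.Complete f (divisors n)
practical⇔complete = mk⇔
  (λ { practical zero _ → [] , minimum _ , refl
     ; practical m@(suc _) m≤ → practical m (s≤s z≤n) m≤ })
  (λ complete m _ → complete m)

module _ {f : ℕ → ℕ} (additive : Additive f) {n : ℕ} (n>0 : 0 < n) where
  open Weighted f

  reachable-* : ∀ {a b} → 1 < a → Coprime a b → a * b ∣ n →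
    Reachable (divisors n) (f a) → Reachable (divisors n) (f b) → Reachable (divisors n) (f (a * b))
  reachable-* {a} {b} 1<a coprime ab∣n ra rb =
    subst (Reachable (divisors n)) (sym (additive a b (<-trans z<s 1<a) (∣⇒>0 n>0 b∣n) coprime))
      (reachable-+ (∣⇒∈-divisors n>0 a∣n) (∣⇒∈-divisors n>0 b∣n) a≢b ra rb)
    where
    a∣n = ∣-trans (m∣m*n b) ab∣n
    b∣n = ∣-trans (n∣m*n a) ab∣n
    a≢b : a ≢ b
    a≢b refl = >⇒≢ 1<a (coprime (∣-refl , ∣-refl))

  -- The right-hand side of lemma6p1, up to unfolding smallSum.
  PrimePowersReachable : Set
  PrimePowersReachable = ∀ p e → Prime p → 1 ≤ e → p ^ e ∣ n → Reachable (divisors n) (f (p ^ e))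

  prime-powers⇒reachable : PrimePowersReachable → ∀ d → d ∣ n → Reachable (divisors n) (f d)
  prime-powers⇒reachable prime-powers = <-rec (λ d → d ∣ n → Reachable (divisors n) (f d)) reach
    where
    reach-split : ∀ {d} → 1 < d → (∀ {d′} → d′ < d → d′ ∣ n → Reachable (divisors n) (f d′)) →
      d ∣ n → Reachable (divisors n) (f d)
    reach-split 1<d rec d∣n with p , e , r , p-prime , refl , p∤r ← prime-power-split 1<d =
      reachable-* 1<p^1+e (prime^-coprime (suc e) p-prime p∤r) d∣n
        (prime-powers p (suc e) p-prime (s≤s z≤n) (∣-trans (m∣m*n r) d∣n))
        (rec (subst (r <_) (*-comm r (p ^ suc e)) (m<m*n r (p ^ suc e) {{>-nonZero r>0}} 1<p^1+e))
             (∣-trans (n∣m*n (p ^ suc e)) d∣n))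
      where
      1<p^1+e = ^-monoʳ-< p (prime⇒>1 p-prime) {0} {suc e} z<s
      r>0 = n≢0⇒n>0 λ { refl → p∤r (p ∣0) }
    reach : ∀ d → (∀ {d′} → d′ < d → d′ ∣ n → Reachable (divisors n) (f d′)) →
      d ∣ n → Reachable (divisors n) (f d)
    reach 0 _ 0∣n = ⊥-elim (>⇒≢ n>0 (0∣⇒≡0 0∣n))
    reach 1 _ _ = subst (Reachable (divisors n)) (sym (Additive⇒f[1]≡0 {f} additive)) z≤n
    reach d@(suc (suc _)) = reach-split {d} (s≤s (s≤s z≤n))

  reachable⇔prime-powers : All (Reachable (divisors n) ∘ f) (divisors n) ⇔ PrimePowersReachable
  reachable⇔prime-powers = mk⇔
    (λ reachable _ _ _ _ p^e∣n → All.lookup reachable (∣⇒∈-divisors n>0 p^e∣n))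
    (λ prime-powers → All.tabulate λ d∈ →
       prime-powers⇒reachable prime-powers _ (∈-divisors⇒∣ d∈))

lemma6p1 : (f : ℕ → ℕ) → Additive f → (∀ p → Prime p → 1 ≤ f p) →
    (n : ℕ) → 0 < n →
    Practical f n ⇔
      (∀ p e → Prime p → 1 ≤ e → p ^ e ∣ n → f (p ^ e) ≤ 1 + smallSum f n (f (p ^ e)))
lemma6p1 f additive _ n n>0 =
  reachable⇔prime-powers additive n>0 ⇔-∘ (complete⇔reachable ⇔-∘ practical⇔complete {f} {n})
  where open Weighted f
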